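{- For $n\ge 1$, \[f_{n+1}(x-1)=\sum_{k=0}^n(-1)^{n-k}f^{(k+1)}_{n-k+1}x^k,\] where $f_m(x)$ denotes the Fibonacci polynomial and $f^{(k+1)}_{n-k+1}$ the convolved Fibonacci number.
   Context: Fibonacci numbers: $f_{ -1}=1$, $f_0=0$, $f_1=1$, $f_{m+1}=f_m+f_{m-1}$. Fibonacci polynomials: $f_1(x)=1$, $f_2(x)=x$, $f_{m+1}(x)=xf_m(x)+f_{m-1}(x)$. Convolved Fibonacci numbers: for $0\le k\le n$, $f^{(k+1)}_{n-k+1}=\sum f_{j_1+1}f_{j_2+1}\cdots f_{j_{k+1}+1}$, the sum over all integer tuples $(j_1,\ldots,j_{k+1})$ with $j_t\ge 0$ and $j_1+\cdots+j_{k+1}=n-k$. -}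

module Defs where

open import Level using (Level)
open import Data.Nat using (ℕ; zero; suc; _∸_)
import Data.Nat as ℕ
open import Data.List using (List; []; _∷_; map; concatMap; upTo; foldr)
open import Data.Vec using (Vec; []; _∷_)
open import Algebra.Bundles using (CommutativeRing)

fib : ℕ → ℕ
fib zero = 0
fib (suc zero) = 1
fib (suc (suc m)) = fib (suc m) ℕ.+ fib m

vsum : ∀ {r} → Vec ℕ r → ℕ
vsum [] = 0
vsum (j ∷ js) = j ℕ.+ vsum js

tuples : (r s : ℕ) → List (Vec ℕ r)
tuples zero zero = [] ∷ []
tuples zero (suc s) = []
tuples (suc r) s = concatMap (λ j → map (j ∷_) (tuples r (s ∸ j))) (upTo (suc s))

fibProd : ∀ {r} → Vec ℕ r → ℕ
fibProd [] = 1
fibProd (j ∷ js) = fib (suc j) ℕ.* fibProd js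

sumℕ : List ℕ → ℕ
sumℕ = foldr ℕ._+_ 0

-- convolved k n  =  f^{(k+1)}_{n-k+1}
--   = Σ over (j_1,…,j_{k+1}), j_t ≥ 0, j_1+⋯+j_{k+1} = n-k, of ∏ f_{j_t+1}
-- (used only for 0 ≤ k ≤ n)
convolved : (k n : ℕ) → ℕ
convolved k n = sumℕ (map fibProd (tuples (suc k) (n ∸ k)))

module RingDefs {c ℓ : Level} (R : CommutativeRing c ℓ) where
  open CommutativeRing R

  pow : Carrier → ℕ → Carrier
  pow x zero = 1#
  pow x (suc m) = x * pow x m

  fromℕ : ℕ → Carrier
  fromℕ zero = 0#
  fromℕ (suc m) = 1# + fromℕ m

  fibPoly : ℕ → Carrier → Carrier
  fibPoly zero x = 0#
  fibPoly (suc zero) x = 1#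
  fibPoly (suc (suc m)) x = x * fibPoly (suc m) x + fibPoly m x

  sumR : List Carrier → Carrier
  sumR = foldr _+_ 0#

  rhs : ℕ → Carrier → Carrier
  rhs n x = sumR (map (λ k → pow (- 1#) (n ∸ k) * (fromℕ (convolved k n) * pow x k))
                      (upTo (suc n)))

-- Let Φ(t) = Σⱼ f_{j+1} tʲ = 1/(1 - t - t²), so that f^{(r)}_{s+1} is the coefficient of tˢ
-- in Φʳ, and let Hₙ(x, y) = Σ_{k+m=n} yᵐ f^{(k+1)}_{m+1} xᵏ, the coefficient of tⁿ in
-- Σₖ (xt)ᵏ Φ(yt)ᵏ⁺¹ = 1/(1 - (x + y)t - y²t²).  Hence H₀ = 1 and Hₙ₊₁ = (x + y)Hₙ + y²Hₙ₋₁,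
-- which at y = -1 is the recurrence of fₙ₊₁(x - 1); the right-hand side is Hₙ(x, -1).
-- No power series are needed: Φ(1 - t - t²) = 1 says f^{(r+1)} = f^{(r)} + t f^{(r+1)} + t² f^{(r+1)}
-- coefficientwise, and summing this along antidiagonals gives the recurrence for H.
module Submission where

open import Defs
open import Level using (Level)
open import Data.Nat using (ℕ; zero; suc; _≥_; _∸_)
open import Data.Nat.Properties using (+-*-semiring)
open import Data.List using (List; []; _∷_; _++_; map; concatMap; upTo; applyUpTo; foldr)
open import Data.List.Properties using (map-++; map-cong; map-upTo)
open import Data.Nat.ListAction.Properties using (sum-++)
open import Data.Vec using (Vec; _∷_)
open import Algebra.Bundles using (Semiring; CommutativeRing)
import Relation.Binary.PropositionalEquality as ≡

module AntidiagonalSums {c ℓ : Level} (S : Semiring c ℓ) where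
  open Semiring S

  -- multiplication by t on generating functions
  shift : (ℕ → Carrier) → ℕ → Carrier
  shift f zero = 0#
  shift f (suc n) = f n

  shift-cong : ∀ {f g : ℕ → Carrier} → (∀ n → f n ≈ g n) → ∀ n → shift f n ≈ shift g n
  shift-cong eq zero = refl
  shift-cong eq (suc n) = eq n

  shift-*ˡ : ∀ a f n → shift (λ m → a * f m) n ≈ a * shift f n
  shift-*ˡ a f zero = sym (zeroʳ a)
  shift-*ˡ a f (suc n) = refl

  antidiagonalSum : ℕ → (ℕ → ℕ → Carrier) → Carrier
  antidiagonalSum zero g = g 0 0
  antidiagonalSum (suc n) g = g 0 (suc n) + antidiagonalSum n (λ k → g (suc k))

  antidiagonalSum-cong : ∀ n {g h : ℕ → ℕ → Carrier} → (∀ k m → g k m ≈ h k m) →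
    antidiagonalSum n g ≈ antidiagonalSum n h
  antidiagonalSum-cong zero eq = eq 0 0
  antidiagonalSum-cong (suc n) eq =
    +-cong (eq 0 (suc n)) (antidiagonalSum-cong n (λ k → eq (suc k)))

  antidiagonalSum-+ : ∀ n g h →
    antidiagonalSum n (λ k m → g k m + h k m) ≈ antidiagonalSum n g + antidiagonalSum n h
  antidiagonalSum-+ zero g h = refl
  antidiagonalSum-+ (suc n) g h =
    trans (+-congˡ (antidiagonalSum-+ n (λ k → g (suc k)) (λ k → h (suc k)))) (interchange _ _ _ _)
    where open import Algebra.Properties.CommutativeSemigroup +-commutativeSemigroup using (interchange)

  antidiagonalSum-*ˡ : ∀ n a g → antidiagonalSum n (λ k m → a * g k m) ≈ a * antidiagonalSum n g
  antidiagonalSum-*ˡ zero a g = refl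
  antidiagonalSum-*ˡ (suc n) a g =
    trans (+-congˡ (antidiagonalSum-*ˡ n a (λ k → g (suc k)))) (sym (distribˡ a _ _))

  antidiagonalSum-shift : ∀ n g →
    antidiagonalSum n (λ k → shift (g k)) ≈ shift (λ n → antidiagonalSum n g) n
  antidiagonalSum-shift zero g = refl
  antidiagonalSum-shift (suc n) g =
    trans (+-congˡ (antidiagonalSum-shift n (λ k → g (suc k)))) (lemma n)
    where
    lemma : ∀ n → g 0 n + shift (λ n → antidiagonalSum n (λ k → g (suc k))) n ≈ antidiagonalSum n g
    lemma zero = +-identityʳ (g 0 0)
    lemma (suc n) = refl

  antidiagonalSum-upTo : ∀ n g →
    foldr _+_ 0# (map (λ k → g k (n ∸ k)) (upTo (suc n))) ≈ antidiagonalSum n g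
  antidiagonalSum-upTo n g = trans (reflexive (≡.cong (foldr _+_ 0#) (map-upTo _ (suc n)))) (go n g)
    where
    go : ∀ n g → foldr _+_ 0# (applyUpTo (λ k → g k (n ∸ k)) (suc n)) ≈ antidiagonalSum n g
    go zero g = +-identityʳ (g 0 0)
    go (suc n) g = +-congˡ (go n (λ k → g (suc k)))

module ℕ-Sums = AntidiagonalSums +-*-semiring

module FibonacciConvolution where
  open ℕ-Sums
  open import Data.Nat using (_+_; _*_)
  open import Data.Nat.Properties using (+-identityʳ; *-identityˡ; *-distribʳ-+; *-distribˡ-+; *-zeroʳ)
  open ≡ using (_≡_; refl; sym; trans; cong; cong₂; module ≡-Reasoning)
  open ≡-Reasoning
  open import Data.Nat.ListAction using (sum)

  -- fibConvolution r s = f^{(r)}_{s+1}, so  convolved k n ≡ fibConvolution (suc k) (n ∸ k)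
  fibConvolution : ℕ → ℕ → ℕ
  fibConvolution r s = sumℕ (map fibProd (tuples r s))

  fibSuc : ℕ → ℕ
  fibSuc j = fib (suc j)

  δ : ℕ → ℕ
  δ zero = 1
  δ (suc _) = 0

  _⋆_ : (ℕ → ℕ) → (ℕ → ℕ) → ℕ → ℕ
  (a ⋆ b) s = antidiagonalSum s (λ j m → a j * b m)

  ⋆-congˡ : ∀ {a a′} b → (∀ j → a j ≡ a′ j) → ∀ s → (a ⋆ b) s ≡ (a′ ⋆ b) s
  ⋆-congˡ b eq s = antidiagonalSum-cong s (λ j m → cong (_* b m) (eq j))

  ⋆-distribʳ-+ : ∀ a a′ b s → ((λ j → a j + a′ j) ⋆ b) s ≡ (a ⋆ b) s + (a′ ⋆ b) s
  ⋆-distribʳ-+ a a′ b s = trans (antidiagonalSum-cong s (λ j m → *-distribʳ-+ (b m) (a j) (a′ j)))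
                                (antidiagonalSum-+ s (λ j m → a j * b m) (λ j m → a′ j * b m))

  δ-⋆ : ∀ b s → (δ ⋆ b) s ≡ b s
  δ-⋆ b zero = *-identityˡ (b 0)
  δ-⋆ b (suc s) = trans (cong₂ _+_ (*-identityˡ (b (suc s))) (antidiagonalSum-*ˡ s 0 (λ _ → b)))
                        (+-identityʳ (b (suc s)))

  shift-⋆ : ∀ a b s → (shift a ⋆ b) s ≡ shift (a ⋆ b) s
  shift-⋆ a b zero = refl
  shift-⋆ a b (suc s) = refl

  fibSuc-rec : ∀ j → fibSuc j ≡ δ j + shift fibSuc j + shift (shift fibSuc) j
  fibSuc-rec zero = refl
  fibSuc-rec (suc zero) = refl
  fibSuc-rec (suc (suc j)) = refl

  sum-map-concatMap : ∀ {A B : Set} (f : A → ℕ) (g : B → List A) xs →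
    sum (map f (concatMap g xs)) ≡ sum (map (λ x → sum (map f (g x))) xs)
  sum-map-concatMap f g [] = refl
  sum-map-concatMap f g (x ∷ xs) = begin
    sum (map f (g x ++ concatMap g xs))                 ≡⟨ cong sum (map-++ f (g x) _) ⟩
    sum (map f (g x) ++ map f (concatMap g xs))         ≡⟨ sum-++ (map f (g x)) _ ⟩
    sum (map f (g x)) + sum (map f (concatMap g xs))
      ≡⟨ cong (sum (map f (g x)) +_) (sum-map-concatMap f g xs) ⟩
    sum (map f (g x)) + sum (map (λ x → sum (map f (g x))) xs) ∎

  sum-fibProd-cons : ∀ {r} j (vs : List (Vec ℕ r)) →
    sum (map fibProd (map (j ∷_) vs)) ≡ fibSuc j * sum (map fibProd vs)
  sum-fibProd-cons j [] = sym (*-zeroʳ (fibSuc j))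
  sum-fibProd-cons j (v ∷ vs) =
    trans (cong (fibSuc j * fibProd v +_) (sum-fibProd-cons j vs))
          (sym (*-distribˡ-+ (fibSuc j) (fibProd v) _))

  -- splitting off the first entry of the tuple
  fibConvolution-suc : ∀ r s → fibConvolution (suc r) s ≡ (fibSuc ⋆ fibConvolution r) s
  fibConvolution-suc r s = begin
    sum (map fibProd (concatMap (λ j → map (j ∷_) (tuples r (s ∸ j))) (upTo (suc s))))
      ≡⟨ sum-map-concatMap fibProd (λ j → map (j ∷_) (tuples r (s ∸ j))) (upTo (suc s)) ⟩
    sum (map (λ j → sum (map fibProd (map (j ∷_) (tuples r (s ∸ j))))) (upTo (suc s)))
      ≡⟨ cong sum (map-cong (λ j → sum-fibProd-cons j (tuples r (s ∸ j))) (upTo (suc s))) ⟩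
    sum (map (λ j → fibSuc j * fibConvolution r (s ∸ j)) (upTo (suc s)))
      ≡⟨ antidiagonalSum-upTo s (λ j m → fibSuc j * fibConvolution r m) ⟩
    (fibSuc ⋆ fibConvolution r) s ∎

  fibConvolution-rec : ∀ r s → fibConvolution (suc r) s ≡
    fibConvolution r s + shift (fibConvolution (suc r)) s + shift (shift (fibConvolution (suc r))) s
  fibConvolution-rec r s = begin
    fibConvolution (suc r) s
      ≡⟨ fibConvolution-suc r s ⟩
    (fibSuc ⋆ c) s
      ≡⟨ ⋆-congˡ c fibSuc-rec s ⟩
    ((λ j → δ j + shift fibSuc j + shift (shift fibSuc) j) ⋆ c) s
      ≡⟨ ⋆-distribʳ-+ (λ j → δ j + shift fibSuc j) (shift (shift fibSuc)) c s ⟩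
    ((λ j → δ j + shift fibSuc j) ⋆ c) s + (shift (shift fibSuc) ⋆ c) s
      ≡⟨ cong (_+ (shift (shift fibSuc) ⋆ c) s) (⋆-distribʳ-+ δ (shift fibSuc) c s) ⟩
    (δ ⋆ c) s + (shift fibSuc ⋆ c) s + (shift (shift fibSuc) ⋆ c) s
      ≡⟨ cong₂ _+_ (cong₂ _+_ (δ-⋆ c s) (shift-⋆ fibSuc c s))
                   (trans (shift-⋆ (shift fibSuc) c s) (shift-cong (shift-⋆ fibSuc c) s)) ⟩
    c s + shift (fibSuc ⋆ c) s + shift (shift (fibSuc ⋆ c)) s
      ≡⟨ cong₂ _+_ (cong (c s +_) (shift-cong c′-eq s)) (shift-cong (shift-cong c′-eq) s) ⟩
    c s + shift (fibConvolution (suc r)) s + shift (shift (fibConvolution (suc r))) s ∎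
    where
    c = fibConvolution r
    c′-eq : ∀ s → (fibSuc ⋆ c) s ≡ fibConvolution (suc r) s
    c′-eq s = sym (fibConvolution-suc r s)

module ConvolutionPolynomial {c ℓ : Level} (R : CommutativeRing c ℓ) where
  open CommutativeRing R
  open RingDefs R
  open import Data.Nat using () renaming (_+_ to _+ℕ_)
  open AntidiagonalSums semiring
  open FibonacciConvolution using (fibConvolution; fibConvolution-rec)
  open import Relation.Binary.Reasoning.Setoid setoid
  open import Algebra.Properties.CommutativeSemigroup *-commutativeSemigroup using (x∙yz≈y∙xz)
  open import Algebra.Properties.Ring ring using (-1*x≈-x; -‿involutive)

  fromℕ-+ : ∀ a b → fromℕ (a +ℕ b) ≈ fromℕ a + fromℕ b
  fromℕ-+ zero b = sym (+-identityˡ (fromℕ b))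
  fromℕ-+ (suc a) b = trans (+-congˡ (fromℕ-+ a b)) (sym (+-assoc 1# (fromℕ a) (fromℕ b)))

  module _ (x y : Carrier) where

    monomial : ℕ → ℕ → ℕ → Carrier
    monomial k m a = pow y m * (fromℕ a * pow x k)

    monomial-+ : ∀ k m a b → monomial k m (a +ℕ b) ≈ monomial k m a + monomial k m b
    monomial-+ k m a b = begin
      pow y m * (fromℕ (a +ℕ b) * pow x k)               ≈⟨ *-congˡ (*-congʳ (fromℕ-+ a b)) ⟩
      pow y m * ((fromℕ a + fromℕ b) * pow x k)           ≈⟨ *-congˡ (distribʳ (pow x k) _ _) ⟩
      pow y m * (fromℕ a * pow x k + fromℕ b * pow x k)   ≈⟨ distribˡ (pow y m) _ _ ⟩
      monomial k m a + monomial k m b                     ∎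

    monomial-shift : ∀ k a m →
      monomial k m (ℕ-Sums.shift a m) ≈ y * shift (λ m → monomial k m (a m)) m
    monomial-shift k a zero = begin
      1# * (0# * pow x k) ≈⟨ *-identityˡ _ ⟩
      0# * pow x k        ≈⟨ zeroˡ _ ⟩
      0#                  ≈⟨ zeroʳ y ⟨
      y * 0#              ∎
    monomial-shift k a (suc m) = *-assoc y (pow y m) _

    term : ℕ → ℕ → Carrier
    term k m = monomial k m (fibConvolution (suc k) m)

    H : ℕ → Carrier
    H n = antidiagonalSum n term

    term-rec : ∀ k m → term k m ≈
      monomial k m (fibConvolution k m) + y * shift (term k) m + y * (y * shift (shift (term k)) m)
    term-rec k m = begin
      monomial k m (fibConvolution (suc k) m)
        ≈⟨ reflexive (≡.cong (monomial k m) (fibConvolution-rec k m)) ⟩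
      monomial k m (fibConvolution k m +ℕ shiftℕ c′ m +ℕ shiftℕ (shiftℕ c′) m)
        ≈⟨ trans (monomial-+ k m (fibConvolution k m +ℕ shiftℕ c′ m) _)
                 (+-congʳ (monomial-+ k m (fibConvolution k m) _)) ⟩
      monomial k m (fibConvolution k m) + monomial k m (shiftℕ c′ m) + monomial k m (shiftℕ (shiftℕ c′) m)
        ≈⟨ +-cong (+-congˡ (monomial-shift k c′ m)) (monomial-shift k (shiftℕ c′) m) ⟩
      monomial k m (fibConvolution k m) + y * shift (term k) m
        + y * shift (λ m → monomial k m (shiftℕ c′ m)) m
        ≈⟨ +-congˡ (*-congˡ (shift-cong (monomial-shift k c′) m)) ⟩
      monomial k m (fibConvolution k m) + y * shift (term k) m
        + y * shift (λ m → y * shift (term k) m) m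
        ≈⟨ +-congˡ (*-congˡ (shift-*ˡ y (shift (term k)) m)) ⟩
      monomial k m (fibConvolution k m) + y * shift (term k) m + y * (y * shift (shift (term k)) m) ∎
      where
      open ℕ-Sums using () renaming (shift to shiftℕ)
      c′ = fibConvolution (suc k)

    -- the k = 0 term vanishes since f^{(0)}_{n+2} = 0
    antidiagonalSum-monomial : ∀ n →
      antidiagonalSum (suc n) (λ k m → monomial k m (fibConvolution k m)) ≈ x * H n
    antidiagonalSum-monomial n = begin
      pow y (suc n) * (0# * 1#)
        + antidiagonalSum n (λ k m → monomial (suc k) m (fibConvolution (suc k) m))
        ≈⟨ +-cong (trans (*-congˡ (zeroˡ 1#)) (zeroʳ _))
                  (antidiagonalSum-cong n (λ k m → trans (*-congˡ (x∙yz≈y∙xz _ x _)) (x∙yz≈y∙xz _ x _))) ⟩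
      0# + antidiagonalSum n (λ k m → x * term k m)
        ≈⟨ trans (+-identityˡ _) (antidiagonalSum-*ˡ n x term) ⟩
      x * H n ∎

    H-zero : H 0 ≈ 1#
    H-zero = trans (*-identityˡ _) (trans (*-identityʳ _) (+-identityʳ 1#))

    H-suc : ∀ n → H (suc n) ≈ x * H n + y * H n + y * (y * shift H n)
    H-suc n = begin
      antidiagonalSum (suc n) term
        ≈⟨ antidiagonalSum-cong (suc n) term-rec ⟩
      antidiagonalSum (suc n) (λ k m → G k m + S₁ k m + S₂ k m)
        ≈⟨ trans (antidiagonalSum-+ (suc n) (λ k m → G k m + S₁ k m) S₂)
                 (+-congʳ (antidiagonalSum-+ (suc n) G S₁)) ⟩
      antidiagonalSum (suc n) G + antidiagonalSum (suc n) S₁ + antidiagonalSum (suc n) S₂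
        ≈⟨ +-cong (+-cong (antidiagonalSum-monomial n) (antidiagonalSum-*ˡ (suc n) y (λ k → shift (term k))))
                  (trans (antidiagonalSum-*ˡ (suc n) y (λ k m → y * shift (shift (term k)) m))
                         (*-congˡ (antidiagonalSum-*ˡ (suc n) y (λ k → shift (shift (term k)))))) ⟩
      x * H n + y * antidiagonalSum (suc n) (λ k → shift (term k))
        + y * (y * antidiagonalSum (suc n) (λ k → shift (shift (term k))))
        ≈⟨ +-cong (+-congˡ (*-congˡ (antidiagonalSum-shift (suc n) term)))
                  (*-congˡ (*-congˡ (trans (antidiagonalSum-shift (suc n) (λ k → shift (term k)))
                                           (antidiagonalSum-shift n term)))) ⟩
      x * H n + y * H n + y * (y * shift H n) ∎
      where
      G S₁ S₂ : ℕ → ℕ → Carrier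
      G k m = monomial k m (fibConvolution k m)
      S₁ k m = y * shift (term k) m
      S₂ k m = y * (y * shift (shift (term k)) m)

  -1*[-1*x]≈x : ∀ a → - 1# * (- 1# * a) ≈ a
  -1*[-1*x]≈x a = trans (-1*x≈-x _) (trans (-‿cong (-1*x≈-x a)) (-‿involutive a))

  fibPoly≈shift-H : ∀ x n → fibPoly n (x - 1#) ≈ shift (H x (- 1#)) n
  fibPoly≈shift-H x zero = refl
  fibPoly≈shift-H x (suc zero) = sym (H-zero x (- 1#))
  fibPoly≈shift-H x (suc (suc n)) = begin
    (x - 1#) * fibPoly (suc n) (x - 1#) + fibPoly n (x - 1#)
      ≈⟨ +-cong (*-congˡ (fibPoly≈shift-H x (suc n))) (fibPoly≈shift-H x n) ⟩
    (x - 1#) * H′ n + shift H′ n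
      ≈⟨ +-cong (distribʳ (H′ n) x (- 1#)) (sym (-1*[-1*x]≈x (shift H′ n))) ⟩
    x * H′ n + - 1# * H′ n + - 1# * (- 1# * shift H′ n)
      ≈⟨ H-suc x (- 1#) n ⟨
    H′ (suc n) ∎
    where
    H′ = H x (- 1#)

  rhs≈H : ∀ n x → rhs n x ≈ H x (- 1#) n
  rhs≈H n x = antidiagonalSum-upTo n (term x (- 1#))

mainTheorem2 : ∀ {c ℓ : Level} (R : CommutativeRing c ℓ) → (n : ℕ) → n ≥ 1 →
    (x : CommutativeRing.Carrier R) →
    CommutativeRing._≈_ R
      (RingDefs.fibPoly R (suc n) (CommutativeRing._-_ R x (CommutativeRing.1# R)))
      (RingDefs.rhs R n x)
mainTheorem2 R n _ x = trans (fibPoly≈shift-H x (suc n)) (sym (rhs≈H n x))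
  where
  open CommutativeRing R using (trans; sym)
  open ConvolutionPolynomial R
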